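{- In Gödel's sequent system $\mathcal{G}$, the structural rule of contraction is derivable: for all formulas $P,Q$ and every finite sequence of formulas $\Delta$, if the sequent $\Delta,P,P\rightarrow Q$ is provable in $\mathcal{G}$, then the sequent $\Delta,P\rightarrow Q$ is provable in $\mathcal{G}$.
   Context: Formulas are built from propositional letters $p,q,r,\ldots$ with the connectives $\sim$ (negation) and $\supset$ (implication). A sequent has the form $\Delta\rightarrow P$, where $\Delta$ is a finite, possibly empty, sequence of formulas and $P$ is a formula. Gödel's system $\mathcal{G}$ has as axioms all sequents $P\rightarrow P$, and the following rules (premises above, conclusion below, written premise(s) / conclusion): thinning: from $\Delta\rightarrow Q$ infer $P,\Delta\rightarrow Q$, and from $\Delta\rightarrow Q$ infer $\Delta,P\rightarrow Q$; implication introduction: from $\Delta,P\rightarrow Q$ infer $\Delta\rightarrow P\supset Q$; implication elimination: from $\Delta\rightarrow P$ and $\Delta\rightarrow P\supset Q$ infer $\Delta\rightarrow Q$ (same $\Delta$ in both premises); reductio ad absurdum: from $\Delta,\sim P\rightarrow Q$ and $\Delta,\sim P\rightarrow\,\sim Q$ infer $\Delta\rightarrow P$. A sequent is provable if it is obtained from axioms by finitely many applications of the rules. -}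

module Defs where

open import Data.Nat using (ℕ)
open import Data.List using (List; []; _∷_; _++_; [_])

data Formula : Set where
  var : ℕ → Formula
  ~_  : Formula → Formula
  _⊃_ : Formula → Formula → Formula

infix 30 ~_
infixr 20 _⊃_
infix 10 _⇒_

-- A sequent Δ → P, with Δ a finite sequence (list) of formulas.
-- "Δ , P" is Δ ++ [ P ] (P appended at the right end).
-- Provability in Gödel's system 𝒢.
data _⇒_ : List Formula → Formula → Set where
  ax       : ∀ {P} → [ P ] ⇒ P
  thinL    : ∀ {Δ P Q} → Δ ⇒ Q → (P ∷ Δ) ⇒ Q
  thinR    : ∀ {Δ P Q} → Δ ⇒ Q → (Δ ++ [ P ]) ⇒ Q
  ⊃I       : ∀ {Δ P Q} → (Δ ++ [ P ]) ⇒ Q → Δ ⇒ P ⊃ Q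
  ⊃E       : ∀ {Δ P Q} → Δ ⇒ P → Δ ⇒ P ⊃ Q → Δ ⇒ Q
  raa      : ∀ {Δ P Q} → (Δ ++ [ ~ P ]) ⇒ Q → (Δ ++ [ ~ P ]) ⇒ ~ Q → Δ ⇒ P

module Submission where

open import Defs
open import Data.List using (List; []; _∷_; _++_; [_])

thinL* : ∀ Γ {Δ Q} → Δ ⇒ Q → (Γ ++ Δ) ⇒ Q
thinL* []      d = d
thinL* (_ ∷ Γ) d = thinL (thinL* Γ d)

last-⇒ : ∀ Δ P → (Δ ++ [ P ]) ⇒ P
last-⇒ Δ P = thinL* Δ ax

mainTheorem1 : (Δ : List Formula) (P Q : Formula)
    → ((Δ ++ [ P ]) ++ [ P ]) ⇒ Q
    → (Δ ++ [ P ]) ⇒ Q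
mainTheorem1 Δ P Q d = ⊃E (last-⇒ Δ P) (⊃I d)
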